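{- Let $p$ be an odd prime, let $\Delta\in\mathbb{Z}$ with $\Delta\equiv3\pmod4$ be a quadratic non-residue modulo $p$, let $\mathfrak{p}=p\mathbb{Z}[\sqrt{\Delta}]$, and let $A_p=\prod_{k=0}^{p-1}(k+\sqrt{\Delta})\in\mathbb{Z}[\sqrt{\Delta}]$. Then $$A_p^{\frac{(p-1)(p-3)}{4}}\equiv\begin{cases}\Delta^{ -\frac{p-1}{4}}\pmod{\mathfrak{p}}&\text{if } p\equiv1\pmod4,\\(-1)^{\frac{p-3}{4}}\pmod{\mathfrak{p}}&\text{if } p\equiv3\pmod4.\end{cases}$$
   Context: $\mathbb{Z}[\sqrt{\Delta}]/\mathfrak{p}$ is a field with $p^2$ elements (as $p$ is inert in $\mathbb{Q}(\sqrt{\Delta})$); the inverse power $\Delta^{ -\frac{p-1}{4}}$ is taken in this field. -}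

module Defs where

open import Data.Nat using (ℕ; zero; suc)
open import Data.Integer using (ℤ; +_; _+_; _*_; _-_; -_)
open import Data.Integer.Divisibility using (_∣_)
open import Data.Product using (_×_; ∃)
open import Relation.Nullary using (¬_)

infix 4 _+√_
record ℤ√ : Set where
  constructor _+√_
  field
    re : ℤ
    im : ℤ
open ℤ√ public

module _ (Δ : ℤ) where
  mul : ℤ√ → ℤ√ → ℤ√
  mul (a +√ b) (c +√ d) = (a * c + b * d * Δ) +√ (a * d + b * c)

  one : ℤ√
  one = + 1 +√ + 0

  pow : ℤ√ → ℕ → ℤ√
  pow x zero    = one
  pow x (suc n) = mul x (pow x n)

  prodA : ℕ → ℤ√
  prodA zero    = one
  prodA (suc n) = mul (prodA n) ((+ n) +√ (+ 1))

  A : ℕ → ℤ√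
  A p = prodA p

ι : ℤ → ℤ√
ι a = a +√ + 0

-- x ≡ y (mod p ℤ[√Δ]) : p divides both coordinates of x - y
infix 2 _≡_[mod_]
_≡_[mod_] : ℤ√ → ℤ√ → ℕ → Set
x ≡ y [mod p ] = ((+ p) ∣ (re x - re y)) × ((+ p) ∣ (im x - im y))

-- Δ is a quadratic non-residue modulo p: no integer square is ≡ Δ (mod p)
-- (this in particular forces p ∤ Δ, since 0 = 0²).
QNR : ℤ → ℕ → Set
QNR Δ p = ¬ (∃ λ (x : ℤ) → (+ p) ∣ (x * x - Δ))

_^ℤ_ : ℤ → ℕ → ℤ
a ^ℤ zero  = + 1
a ^ℤ suc n = a * (a ^ℤ n)

-- Work in ℤ[√Δ]/p.  Modulo p the rising factorial ∏_{k<p} (x + k) equals x^p − x coefficientwise: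
-- their difference has degree < p and, by Fermat, vanishes at 0, …, p − 1, so Lagrange's theorem
-- over ℤ/p kills it.  Hence A_p ≡ √Δ^p − √Δ = √Δ (Δ^h − 1), where p = 2h + 1.  Each factor k + √Δ
-- has norm k² − Δ ≢ 0 because Δ is a non-residue, so A_p ≢ 0; as Δ^h ≡ ±1, this forces Euler's
-- criterion Δ^h ≡ −1, whence A_p ≡ −2√Δ and A_p² ≡ 4Δ.  The exponent (p − 1)(p − 3)/4 is even, so
-- the claim becomes a statement about powers of 4Δ in ℤ/p, where (4Δ)^h ≡ 2^{p−1} Δ^h ≡ −1.  For
-- p = 4q + 3 this is the result; for p = 4q + 1 one also needs 2^{2q} ≡ (−1)^q, which follows by
-- comparing (1 + i)^p = (1 + i)(2i)^{2q} with the Frobenius value 1 + i^p = 1 + i in ℤ[i]/p.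

module Submission where

open import Defs
open import Level using (0ℓ)
open import Algebra.Bundles using (CommutativeRing)
open import Algebra.Morphism.Structures using (module RingMorphisms)
import Algebra.Morphism.Construct.Composition as Composition
open import Function using (id)
open import Data.Nat using (ℕ; zero; suc; _<_; _∸_; _!; z≤n; s≤s)
import Data.Nat as ℕ
import Data.Nat.Properties as ℕ
import Data.Nat.Divisibility as ℕ
open import Data.Nat.Divisibility using (_∤_; divides; ∣1⇒≡1; ∣⇒≤; m∣m*n)
open import Data.Nat.Primality using (Prime; prime; euclidsLemma; prime⇒nonZero)
open import Data.Nat.Combinatorics using (_C_; nCn≡1; nCk≡n!/k![n-k]!; k![n∸k]!∣n!)
open import Data.Nat.DivMod using (m/n*n≡m; m*n/n≡m; m≡m%n+[m/n]*n)
open import Data.Fin using (Fin; zero; suc; fromℕ; inject₁)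
import Data.Fin.Properties as Fin
open import Data.Integer using (ℤ; +_; -[1+_])
import Data.Integer as Int
import Data.Integer.Properties as IntP
import Data.Integer.Divisibility.Signed as Signed
open import Data.Integer.Tactic.RingSolver using (solve-∀)
open import Data.Nat.Tactic.RingSolver using () renaming (solve-∀ to ℕ-solve-∀)
open import Data.Vec using (Vec; []; _∷_; map)
open import Data.Vec.Relation.Unary.All as All using (All; []; _∷_)
import Data.Vec.Relation.Unary.All.Properties as All
open import Data.Product using (_,_)
open import Data.Sum as Sum using (_⊎_; inj₁; inj₂; [_,_]′)
open import Data.Maybe using (nothing)
open import Relation.Nullary using (¬_; contradiction; yes; no)
open import Relation.Binary.PropositionalEquality as ≡ using (_≡_; refl; cong; subst)
import Tactic.RingSolver.Core.AlmostCommutativeRing as ACR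
import Tactic.RingSolver.NonReflective as NonReflective

-- An abstract ring has no zero test, so this solver only proves identities that need no cancellation.
module RingSolver {c ℓ} (R : CommutativeRing c ℓ) =
  NonReflective (ACR.fromCommutativeRing R (λ _ → nothing))

prime>1 : ∀ {p} → Prime p → 1 < p
prime>1 {p} (prime {{p>1}} _) = ℕ.nonTrivial⇒n>1 p {{p>1}}

prime∤! : ∀ {p} → Prime p → ∀ {m} → m < p → p ∤ m !
prime∤! pp {zero}  _   p∣1 = ℕ.<⇒≢ (prime>1 pp) (≡.sym (∣1⇒≡1 p∣1))
prime∤! pp {suc m} m<p p∣m! with euclidsLemma (suc m) (m !) pp p∣m!
... | inj₁ p∣1+m = ℕ.<⇒≱ m<p (∣⇒≤ p∣1+m)
... | inj₂ p∣m!  = prime∤! pp (ℕ.<-trans (ℕ.n<1+n m) m<p) p∣m!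

n∣n! : ∀ {n} → 0 < n → n ℕ.∣ n !
n∣n! {suc m} _ = m∣m*n (m !)

prime∣C : ∀ {p} → Prime p → ∀ {k} → 0 < k → k < p → p ℕ.∣ p C k
prime∣C {p} pp {k} 0<k k<p with euclidsLemma (p C k) (k ! ℕ.* (p ∸ k) !) pp p∣C*k!*[p-k]!
  where
  instance _ = k ℕ.!* (p ∸ k) !≢0
  C*k!*[p-k]!≡p! : (p C k) ℕ.* (k ! ℕ.* (p ∸ k) !) ≡ p !
  C*k!*[p-k]!≡p! = ≡.trans (cong (ℕ._* (k ! ℕ.* (p ∸ k) !)) (nCk≡n!/k![n-k]! (ℕ.<⇒≤ k<p)))
                           (m/n*n≡m (k![n∸k]!∣n! (ℕ.<⇒≤ k<p)))
  p∣C*k!*[p-k]! : p ℕ.∣ (p C k) ℕ.* (k ! ℕ.* (p ∸ k) !)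
  p∣C*k!*[p-k]! = subst (p ℕ.∣_) (≡.sym C*k!*[p-k]!≡p!) (n∣n! (ℕ.<-trans 0<k k<p))
... | inj₁ p∣C = p∣C
... | inj₂ p∣k!*[p-k]! with euclidsLemma (k !) ((p ∸ k) !) pp p∣k!*[p-k]!
...   | inj₁ p∣k!     = contradiction p∣k! (prime∤! pp k<p)
...   | inj₂ p∣[p-k]! = contradiction p∣[p-k]! (prime∤! pp (ℕ.∸-monoʳ-< 0<k (ℕ.<⇒≤ k<p)))

2<1+2h : ∀ {h} → 1 < suc (h ℕ.+ h) → 2 < suc (h ℕ.+ h)
2<1+2h {zero}  (s≤s ())
2<1+2h {suc h} _ = s≤s (s≤s (subst (1 ℕ.≤_) (≡.sym (ℕ.+-suc h h)) (s≤s z≤n)))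

-- Powers and the Frobenius map

module Powers {c ℓ} (R : CommutativeRing c ℓ) where
  open CommutativeRing R renaming (refl to ≈-refl)
  open import Algebra.Properties.Semiring.Exp semiring using (_^_; ^-congˡ; ^-homo-*)
  open import Algebra.Properties.CommutativeSemiring.Exp commutativeSemiring using (^-distrib-*)
  open import Algebra.Properties.Ring ring using (-1*x≈-x)
  open import Algebra.Properties.Group +-group using (⁻¹-involutive)

  1#^n≈1# : ∀ n → 1# ^ n ≈ 1#
  1#^n≈1# zero    = ≈-refl
  1#^n≈1# (suc n) = trans (*-identityˡ _) (1#^n≈1# n)

  x^[n+n]≈[x*x]^n : ∀ x n → x ^ (n ℕ.+ n) ≈ (x * x) ^ n
  x^[n+n]≈[x*x]^n x n = trans (^-homo-* x n n) (sym (^-distrib-* x x n))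

  [-1]^[n+n]≈1 : ∀ n → (- 1#) ^ (n ℕ.+ n) ≈ 1#
  [-1]^[n+n]≈1 n = trans (x^[n+n]≈[x*x]^n (- 1#) n)
                         (trans (^-congˡ n (trans (-1*x≈-x (- 1#)) (⁻¹-involutive 1#))) (1#^n≈1# n))

module Frobenius {c ℓ} (R : CommutativeRing c ℓ) {p} (pp : Prime p) where
  open CommutativeRing R hiding (zero) renaming (refl to ≈-refl)
  open import Algebra.Properties.CommutativeSemiring.Binomial commutativeSemiring
    using (theorem; binomialTerm)
  open import Algebra.Properties.Semiring.Exp semiring using (_^_; ^-congˡ; ^-congʳ)
  open import Algebra.Properties.Semiring.Mult semiring using (_×_; ×-congʳ; ×-homo-1; ×1-homo-*; ×-assoc-*)
  open import Algebra.Properties.Monoid.Sum +-monoid using (sum; sum-init-last; sum-cong-≋; sum-replicate-zero)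
  open import Algebra.Properties.Group +-group using (inverseʳ-unique)
  open Powers R using (1#^n≈1#)
  open import Relation.Binary.Reasoning.Setoid setoid

  p≡1+pred : p ≡ suc (ℕ.pred p)
  p≡1+pred = ≡.sym (ℕ.suc-pred p {{prime⇒nonZero pp}})

  0#^p≈0# : 0# ^ p ≈ 0#
  0#^p≈0# = trans (^-congʳ 0# p≡1+pred) (zeroˡ _)

  sum≈last : ∀ {m} (f : Fin (suc m) → Carrier) → (∀ i → f (inject₁ i) ≈ 0#) → sum f ≈ f (fromℕ m)
  sum≈last {m} f init≈0 = begin
    sum f                              ≈⟨ sum-init-last f ⟩
    sum (λ i → f (inject₁ i)) + f (fromℕ m) ≈⟨ +-congʳ (trans (sum-cong-≋ init≈0) (sum-replicate-zero m)) ⟩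
    0# + f (fromℕ m)                   ≈⟨ +-identityˡ _ ⟩
    f (fromℕ m)                        ∎

  module _ (char : p × 1# ≈ 0#) where

    p∣m⇒m×x≈0 : ∀ {m} x → p ℕ.∣ m → m × x ≈ 0#
    p∣m⇒m×x≈0 x (divides q refl) = begin
      (q ℕ.* p) × x                   ≈⟨ ×-congʳ (q ℕ.* p) (*-identityˡ x) ⟨
      (q ℕ.* p) × (1# * x)            ≈⟨ ×-assoc-* (q ℕ.* p) 1# x ⟨
      ((q ℕ.* p) × 1#) * x            ≈⟨ *-congʳ (×1-homo-* q p) ⟩
      ((q × 1#) * (p × 1#)) * x       ≈⟨ *-congʳ (*-congˡ char) ⟩
      ((q × 1#) * 0#) * x             ≈⟨ *-congʳ (zeroʳ _) ⟩
      0# * x                          ≈⟨ zeroˡ x ⟩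
      0#                              ∎

    frobenius : ∀ x y → (x + y) ^ p ≈ x ^ p + y ^ p
    frobenius = frobenius-suc p≡1+pred
      where
      frobenius-suc : ∀ {q} → p ≡ suc q → ∀ x y → (x + y) ^ p ≈ x ^ p + y ^ p
      frobenius-suc {q} refl x y = begin
        (x + y) ^ suc q                                 ≈⟨ theorem (suc q) x y ⟩
        term zero + sum (λ i → term (suc i))            ≈⟨ +-cong first (trans (sum≈last (λ i → term (suc i)) middle) last) ⟩
        y ^ suc q + x ^ suc q                           ≈⟨ +-comm _ _ ⟩
        x ^ suc q + y ^ suc q                           ∎
        where
        term : Fin (suc (suc q)) → Carrier
        term = binomialTerm x y (suc q)

        first : term zero ≈ y ^ suc q
        first = trans (+-identityʳ _) (*-identityˡ _)

        middle : ∀ i → term (suc (inject₁ i)) ≈ 0#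
        middle i = p∣m⇒m×x≈0 _ (prime∣C pp (s≤s z≤n) (s≤s (subst (_< q) (≡.sym (Fin.toℕ-inject₁ i)) (Fin.toℕ<n i))))

        last : term (suc (fromℕ q)) ≈ x ^ suc q
        last = begin
          term (suc (fromℕ q))
            ≡⟨ cong (λ k → (suc q C suc k) × (x ^ suc k * y ^ (q ∸ k))) (Fin.toℕ-fromℕ q) ⟩
          (suc q C suc q) × (x ^ suc q * y ^ (q ∸ q))
            ≡⟨ ≡.cong₂ (λ c e → c × (x ^ suc q * y ^ e)) (nCn≡1 (suc q)) (ℕ.n∸n≡0 q) ⟩
          1 × (x ^ suc q * 1#)
            ≈⟨ ×-homo-1 _ ⟩
          x ^ suc q * 1#
            ≈⟨ *-identityʳ _ ⟩
          x ^ suc q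
            ∎

    -‿^p : ∀ x → (- x) ^ p ≈ - (x ^ p)
    -‿^p x = inverseʳ-unique (x ^ p) ((- x) ^ p) (begin
      x ^ p + (- x) ^ p ≈⟨ frobenius x (- x) ⟨
      (x - x) ^ p       ≈⟨ ^-congˡ p (-‿inverseʳ x) ⟩
      0# ^ p            ≈⟨ 0#^p≈0# ⟩
      0#                ∎)

    ×1-^p : ∀ n → (n × 1#) ^ p ≈ n × 1#
    ×1-^p zero    = 0#^p≈0#
    ×1-^p (suc n) = trans (frobenius 1# (n × 1#)) (+-cong (1#^n≈1# p) (×1-^p n))

-- Polynomials, Lagrange's theorem and the rising factorial

module Polynomial {c ℓ} (R : CommutativeRing c ℓ) where
  open CommutativeRing R renaming (refl to ≈-refl)
  open import Algebra.Properties.Group +-group using (x≈y⇒x∙y⁻¹≈ε; x∙y⁻¹≈ε⇒x≈y)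
  open import Algebra.Properties.Ring ring using ([y-z]x≈yx-zx)
  open import Algebra.Properties.Semiring.Exp semiring using (_^_)
  open import Relation.Binary.Reasoning.Setoid setoid
  open RingSolver R

  -- Coefficient vectors start with the constant term.
  ⟦_⟧ : ∀ {n} → Vec Carrier n → Carrier → Carrier
  ⟦ []     ⟧ x = 0#
  ⟦ c ∷ cs ⟧ x = c + x * ⟦ cs ⟧ x

  ⟦⟧≈0 : ∀ {n} {cs : Vec Carrier n} → All (_≈ 0#) cs → ∀ x → ⟦ cs ⟧ x ≈ 0#
  ⟦⟧≈0 []           x = ≈-refl
  ⟦⟧≈0 (c≈0 ∷ cs≈0) x = begin
    _ + x * _   ≈⟨ +-cong c≈0 (*-congˡ (⟦⟧≈0 cs≈0 x)) ⟩
    0# + x * 0# ≈⟨ +-identityˡ _ ⟩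
    x * 0#      ≈⟨ zeroʳ x ⟩
    0#          ∎

  remainder : ∀ {n} → Carrier → Vec Carrier (suc n) → Carrier
  remainder a (c ∷ [])     = c
  remainder a (c ∷ c′ ∷ cs) = c + a * remainder a (c′ ∷ cs)

  quotient : ∀ {n} → Carrier → Vec Carrier (suc n) → Vec Carrier n
  quotient a (c ∷ [])      = []
  quotient a (c ∷ c′ ∷ cs) = remainder a (c′ ∷ cs) ∷ quotient a (c′ ∷ cs)

  remainder≈⟦⟧ : ∀ {n} a (q : Vec Carrier (suc n)) → remainder a q ≈ ⟦ q ⟧ a
  remainder≈⟦⟧ a (c ∷ [])      = sym (trans (+-congˡ (zeroʳ a)) (+-identityʳ c))
  remainder≈⟦⟧ a (c ∷ c′ ∷ cs) = +-congˡ (*-congˡ (remainder≈⟦⟧ a (c′ ∷ cs)))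

  -- q(x) = (x − a) · quotient a q (x) + remainder a q, rearranged to avoid subtraction.
  ⟦⟧-divide : ∀ {n} a (q : Vec Carrier (suc n)) b →
              ⟦ q ⟧ b + a * ⟦ quotient a q ⟧ b ≈ b * ⟦ quotient a q ⟧ b + remainder a q
  ⟦⟧-divide a (c ∷ []) b = begin
    (c + b * 0#) + a * 0# ≈⟨ +-cong (trans (+-congˡ (zeroʳ b)) (+-identityʳ c)) (zeroʳ a) ⟩
    c + 0#                ≈⟨ +-comm c 0# ⟩
    0# + c                ≈⟨ +-congʳ (zeroʳ b) ⟨
    b * 0# + c            ∎
  ⟦⟧-divide a (c ∷ c′ ∷ cs) b = begin
    (c + b * Q) + a * (r + b * D)
      ≈⟨ solve 6 (λ c b a Q D r → ((c ⊕ b ⊗ Q) ⊕ a ⊗ (r ⊕ b ⊗ D)) ⊜ ((c ⊕ a ⊗ r) ⊕ b ⊗ (Q ⊕ a ⊗ D)))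
               ≈-refl c b a Q D r ⟩
    (c + a * r) + b * (Q + a * D)
      ≈⟨ +-congˡ (*-congˡ (⟦⟧-divide a (c′ ∷ cs) b)) ⟩
    (c + a * r) + b * (b * D + r)
      ≈⟨ solve 5 (λ c b a D r → ((c ⊕ a ⊗ r) ⊕ b ⊗ (b ⊗ D ⊕ r)) ⊜ (b ⊗ (r ⊕ b ⊗ D) ⊕ (c ⊕ a ⊗ r))) ≈-refl c b a D r ⟩
    b * (r + b * D) + (c + a * r)
      ∎
    where
    Q = ⟦ c′ ∷ cs ⟧ b
    D = ⟦ quotient a (c′ ∷ cs) ⟧ b
    r = remainder a (c′ ∷ cs)

  quotient≈0⇒≈0 : ∀ {n} a (q : Vec Carrier (suc n)) →
                  All (_≈ 0#) (quotient a q) → remainder a q ≈ 0# → All (_≈ 0#) q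
  quotient≈0⇒≈0 a (c ∷ [])      []           c≈0 = c≈0 ∷ []
  quotient≈0⇒≈0 a (c ∷ c′ ∷ cs) (r≈0 ∷ qs≈0) c+ar≈0 = c≈0 ∷ quotient≈0⇒≈0 a (c′ ∷ cs) qs≈0 r≈0
    where
    c≈0 : c ≈ 0#
    c≈0 = begin
      c                             ≈⟨ +-identityʳ c ⟨
      c + 0#                        ≈⟨ +-congˡ (zeroʳ a) ⟨
      c + a * 0#                    ≈⟨ +-congˡ (*-congˡ r≈0) ⟨
      c + a * remainder a (c′ ∷ cs) ≈⟨ c+ar≈0 ⟩
      0#                            ∎

  module _ (xy≈0⇒x≈0∨y≈0 : ∀ {x y} → x * y ≈ 0# → x ≈ 0# ⊎ y ≈ 0#) where

    xz≈yz⇒x≈y∨z≈0 : ∀ {x y z} → x * z ≈ y * z → x ≈ y ⊎ z ≈ 0#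
    xz≈yz⇒x≈y∨z≈0 {x} {y} {z} xz≈yz =
      Sum.map₁ (x∙y⁻¹≈ε⇒x≈y x y) (xy≈0⇒x≈0∨y≈0 (trans ([y-z]x≈yx-zx z x y) (x≈y⇒x∙y⁻¹≈ε xz≈yz)))

    lagrange : ∀ {n} (q : Vec Carrier n) (pt : ℕ → Carrier) →
               (∀ {i j} → i < j → j < n → ¬ pt i ≈ pt j) →
               (∀ {i} → i < n → ⟦ q ⟧ (pt i) ≈ 0#) → All (_≈ 0#) q
    lagrange {zero}  []  pt distinct roots = []
    lagrange {suc m} q pt distinct roots =
      quotient≈0⇒≈0 a q (lagrange (quotient a q) pt (λ i<j j<m → distinct i<j (ℕ.m<n⇒m<1+n j<m)) quotient-roots) r≈0
      where
      a = pt m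
      r≈0 : remainder a q ≈ 0#
      r≈0 = trans (remainder≈⟦⟧ a q) (roots (ℕ.n<1+n m))

      quotient-roots : ∀ {i} → i < m → ⟦ quotient a q ⟧ (pt i) ≈ 0#
      quotient-roots {i} i<m =
        [ (λ b≈a → contradiction b≈a (distinct i<m (ℕ.n<1+n m))) , id ]′ (xz≈yz⇒x≈y∨z≈0 (sym aD≈bD))
        where
        b = pt i
        D = ⟦ quotient a q ⟧ b
        aD≈bD : a * D ≈ b * D
        aD≈bD = begin
          a * D                  ≈⟨ +-identityˡ _ ⟨
          0# + a * D             ≈⟨ +-congʳ (roots (ℕ.<-trans i<m (ℕ.n<1+n m))) ⟨
          ⟦ q ⟧ b + a * D        ≈⟨ ⟦⟧-divide a q b ⟩
          b * D + remainder a q  ≈⟨ +-congˡ r≈0 ⟩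
          b * D + 0#             ≈⟨ +-identityʳ _ ⟩
          b * D                  ∎

  -- The monic polynomial whose coefficients below the leading 1 are the given ones.
  ⟦_⟧ᵐ : ∀ {n} → Vec Carrier n → Carrier → Carrier
  ⟦ []     ⟧ᵐ x = 1#
  ⟦ c ∷ cs ⟧ᵐ x = c + x * ⟦ cs ⟧ᵐ x

  ⟦⟧ᵐ≈^+⟦⟧ : ∀ {n} (cs : Vec Carrier n) x → ⟦ cs ⟧ᵐ x ≈ x ^ n + ⟦ cs ⟧ x
  ⟦⟧ᵐ≈^+⟦⟧ []       x = sym (+-identityʳ 1#)
  ⟦⟧ᵐ≈^+⟦⟧ {suc n} (c ∷ cs) x = begin
    c + x * ⟦ cs ⟧ᵐ x
      ≈⟨ +-congˡ (*-congˡ (⟦⟧ᵐ≈^+⟦⟧ cs x)) ⟩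
    c + x * (x ^ n + ⟦ cs ⟧ x)
      ≈⟨ solve 4 (λ c x P E → (c ⊕ x ⊗ (P ⊕ E)) ⊜ (x ⊗ P ⊕ (c ⊕ x ⊗ E))) ≈-refl c x (x ^ n) (⟦ cs ⟧ x) ⟩
    x * x ^ n + (c + x * ⟦ cs ⟧ x)
      ∎

addHead : ∀ {n} → ℤ → Vec ℤ (suc n) → Vec ℤ (suc n)
addHead c (d ∷ ds) = c Int.+ d ∷ ds

_·[x+_] : ∀ {n} → Vec ℤ n → ℤ → Vec ℤ (suc n)
[]       ·[x+ k ] = k ∷ []
(c ∷ cs) ·[x+ k ] = k Int.* c ∷ addHead c (cs ·[x+ k ])

-- The coefficients below the leading one of ∏_{k<n} (x + k).
risingCoefficients : (n : ℕ) → Vec ℤ n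
risingCoefficients zero    = []
risingCoefficients (suc n) = risingCoefficients n ·[x+ + n ]

-- Adds x to the polynomial; only meaningful when there is a coefficient of x, i.e. for n ≥ 2.
addX : ∀ {n} → Vec ℤ n → Vec ℤ n
addX []            = []
addX (c ∷ [])      = c ∷ []
addX (c₀ ∷ c₁ ∷ cs) = c₀ ∷ c₁ Int.+ + 1 ∷ cs

module RisingFactorial {c ℓ} (R : CommutativeRing c ℓ) {φ : ℤ → CommutativeRing.Carrier R}
  (φ-hom : RingMorphisms.IsRingHomomorphism Int.+-*-rawRing (CommutativeRing.rawRing R) φ) where
  open CommutativeRing R renaming (refl to ≈-refl)
  open RingMorphisms.IsRingHomomorphism φ-hom
  open Polynomial R
  open import Algebra.Properties.Semiring.Exp semiring using (_^_)
  open import Algebra.Properties.CommutativeSemigroup +-commutativeSemigroup using (xy∙z≈xz∙y)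
  open import Relation.Binary.Reasoning.Setoid setoid
  open RingSolver R

  rising : Carrier → ℕ → Carrier
  rising x zero    = 1#
  rising x (suc n) = rising x n * (x + φ (+ n))

  ⟦⟧ᵐ-addHead : ∀ {n} c (ds : Vec ℤ (suc n)) x → ⟦ map φ (addHead c ds) ⟧ᵐ x ≈ φ c + ⟦ map φ ds ⟧ᵐ x
  ⟦⟧ᵐ-addHead c (d ∷ ds) x = trans (+-congʳ (+-homo c d)) (+-assoc (φ c) (φ d) _)

  ⟦⟧ᵐ-·[x+] : ∀ {n} (cs : Vec ℤ n) k x → ⟦ map φ (cs ·[x+ k ]) ⟧ᵐ x ≈ ⟦ map φ cs ⟧ᵐ x * (x + φ k)
  ⟦⟧ᵐ-·[x+] [] k x = begin
    φ k + x * 1#   ≈⟨ +-congˡ (*-identityʳ x) ⟩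
    φ k + x        ≈⟨ +-comm (φ k) x ⟩
    x + φ k        ≈⟨ *-identityˡ _ ⟨
    1# * (x + φ k) ∎
  ⟦⟧ᵐ-·[x+] (c ∷ cs) k x = begin
    φ (k Int.* c) + x * ⟦ map φ (addHead c (cs ·[x+ k ])) ⟧ᵐ x
      ≈⟨ +-cong (*-homo k c) (*-congˡ (⟦⟧ᵐ-addHead c (cs ·[x+ k ]) x)) ⟩
    φ k * φ c + x * (φ c + ⟦ map φ (cs ·[x+ k ]) ⟧ᵐ x)
      ≈⟨ +-congˡ (*-congˡ (+-congˡ (⟦⟧ᵐ-·[x+] cs k x))) ⟩
    φ k * φ c + x * (φ c + M * (x + φ k))
      ≈⟨ solve 4 (λ K C X M → (K ⊗ C ⊕ X ⊗ (C ⊕ M ⊗ (X ⊕ K))) ⊜ ((C ⊕ X ⊗ M) ⊗ (X ⊕ K)))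
                 ≈-refl (φ k) (φ c) x M ⟩
    (φ c + x * M) * (x + φ k) ∎
    where M = ⟦ map φ cs ⟧ᵐ x

  rising≈⟦⟧ᵐ : ∀ x n → rising x n ≈ ⟦ map φ (risingCoefficients n) ⟧ᵐ x
  rising≈⟦⟧ᵐ x zero    = ≈-refl
  rising≈⟦⟧ᵐ x (suc n) = sym (trans (⟦⟧ᵐ-·[x+] (risingCoefficients n) (+ n) x) (*-congʳ (sym (rising≈⟦⟧ᵐ x n))))

  rising≈^+⟦⟧ : ∀ x n → rising x n ≈ x ^ n + ⟦ map φ (risingCoefficients n) ⟧ x
  rising≈^+⟦⟧ x n = trans (rising≈⟦⟧ᵐ x n) (⟦⟧ᵐ≈^+⟦⟧ (map φ (risingCoefficients n)) x)

  rising≈0 : ∀ {x k n} → k < n → x + φ (+ k) ≈ 0# → rising x n ≈ 0#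
  rising≈0 {x} {k} {suc n} k<1+n x+k≈0 with k ℕ.≟ n
  ... | yes refl = trans (*-congˡ x+k≈0) (zeroʳ _)
  ... | no  k≢n  = trans (*-congʳ (rising≈0 (ℕ.≤∧≢⇒< (ℕ.≤-pred k<1+n) k≢n) x+k≈0)) (zeroˡ _)

  ⟦⟧-addX : ∀ {n} (cs : Vec ℤ n) x → 2 ℕ.≤ n → ⟦ map φ (addX cs) ⟧ x ≈ ⟦ map φ cs ⟧ x + x
  ⟦⟧-addX (c₀ ∷ [])     x (s≤s ())
  ⟦⟧-addX (c₀ ∷ c₁ ∷ cs) x _ = begin
    φ c₀ + x * (φ (c₁ Int.+ + 1) + x * E) ≈⟨ +-congˡ (*-congˡ (+-congʳ (trans (+-homo c₁ (+ 1)) (+-congˡ 1#-homo)))) ⟩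
    φ c₀ + x * ((φ c₁ + 1#) + x * E)      ≈⟨ +-congˡ (*-congˡ (xy∙z≈xz∙y (φ c₁) 1# (x * E))) ⟩
    φ c₀ + x * ((φ c₁ + x * E) + 1#)      ≈⟨ +-congˡ (distribˡ x _ 1#) ⟩
    φ c₀ + (x * (φ c₁ + x * E) + x * 1#)  ≈⟨ +-congˡ (+-congˡ (*-identityʳ x)) ⟩
    φ c₀ + (x * (φ c₁ + x * E) + x)       ≈⟨ +-assoc _ _ x ⟨
    (φ c₀ + x * (φ c₁ + x * E)) + x       ∎
    where E = ⟦ map φ cs ⟧ x

module IntegerHomomorphism {c ℓ} (R : CommutativeRing c ℓ) {φ : ℤ → CommutativeRing.Carrier R}
  (φ-hom : RingMorphisms.IsRingHomomorphism Int.+-*-rawRing (CommutativeRing.rawRing R) φ) where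
  open CommutativeRing R
  open RingMorphisms.IsRingHomomorphism φ-hom
  open import Algebra.Properties.Semiring.Mult semiring using (_×_)

  ×1≈φ : ∀ n → n × 1# ≈ φ (+ n)
  ×1≈φ zero    = sym 0#-homo
  ×1≈φ (suc n) = trans (+-cong (sym 1#-homo) (×1≈φ n)) (sym (+-homo (+ 1) (+ n)))

-- The rings ℤ/n and ℤ[√Δ]/n

module IntegersModulo (n : ℕ) where
  open Int using (_+_; _*_; -_; _-_)
  open Signed using (divides; ∣m∣n⇒∣m+n; ∣m⇒∣-m; ∣n⇒∣m*n; ∣m⇒∣m*n)

  -- A record rather than n ∣ a - b itself, so that a and b can be inferred from a proof.
  infix 4 _≈_
  record _≈_ (a b : ℤ) : Set where
    constructor mod-divides
    field divides-diff : + n Signed.∣ a - b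
  open _≈_ public

  ≡⇒≈ : ∀ {a b} → a ≡ b → a ≈ b
  ≡⇒≈ {a} refl = mod-divides (divides (+ 0) (IntP.+-inverseʳ a))

  private
    n∣-resp : ∀ {a b} → a ≡ b → + n Signed.∣ a → + n Signed.∣ b
    n∣-resp refl d = d

    ≈-sym : ∀ {a b} → a ≈ b → b ≈ a
    ≈-sym {a} {b} (mod-divides d) = mod-divides (n∣-resp (identity a b) (∣m⇒∣-m d))
      where identity : ∀ a b → - (a - b) ≡ b - a
            identity = solve-∀

    ≈-trans : ∀ {a b c} → a ≈ b → b ≈ c → a ≈ c
    ≈-trans {a} {b} {c} (mod-divides d) (mod-divides e) = mod-divides (n∣-resp (identity a b c) (∣m∣n⇒∣m+n d e))
      where identity : ∀ a b c → (a - b) + (b - c) ≡ a - c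
            identity = solve-∀

    +-cong : ∀ {a a′ b b′} → a ≈ a′ → b ≈ b′ → a + b ≈ a′ + b′
    +-cong {a} {a′} {b} {b′} (mod-divides d) (mod-divides e) =
      mod-divides (n∣-resp (identity a a′ b b′) (∣m∣n⇒∣m+n d e))
      where identity : ∀ a a′ b b′ → (a - a′) + (b - b′) ≡ (a + b) - (a′ + b′)
            identity = solve-∀

    *-cong : ∀ {a a′ b b′} → a ≈ a′ → b ≈ b′ → a * b ≈ a′ * b′
    *-cong {a} {a′} {b} {b′} (mod-divides d) (mod-divides e) =
      mod-divides (n∣-resp (identity a a′ b b′) (∣m∣n⇒∣m+n (∣m⇒∣m*n b d) (∣n⇒∣m*n a′ e)))
      where identity : ∀ a a′ b b′ → (a - a′) * b + a′ * (b - b′) ≡ a * b - a′ * b′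
            identity = solve-∀

    -‿cong : ∀ {a a′} → a ≈ a′ → - a ≈ - a′
    -‿cong {a} {a′} (mod-divides d) = mod-divides (n∣-resp (identity a a′) (∣m⇒∣-m d))
      where identity : ∀ a a′ → - (a - a′) ≡ - a - - a′
            identity = solve-∀

  ring : CommutativeRing 0ℓ 0ℓ
  ring = record
    { Carrier = ℤ ; _≈_ = _≈_ ; _+_ = _+_ ; _*_ = _*_ ; -_ = -_ ; 0# = + 0 ; 1# = + 1
    ; isCommutativeRing = record
      { isRing = record
        { +-isAbelianGroup = record
          { isGroup = record
            { isMonoid = record
              { isSemigroup = record
                { isMagma = record
                  { isEquivalence = record { refl = ≡⇒≈ refl ; sym = ≈-sym ; trans = ≈-trans }
                  ; ∙-cong = +-cong }
                ; assoc = λ a b c → ≡⇒≈ (IntP.+-assoc a b c) }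
              ; identity = (λ a → ≡⇒≈ (IntP.+-identityˡ a)) , (λ a → ≡⇒≈ (IntP.+-identityʳ a)) }
            ; inverse = (λ a → ≡⇒≈ (IntP.+-inverseˡ a)) , (λ a → ≡⇒≈ (IntP.+-inverseʳ a))
            ; ⁻¹-cong = -‿cong }
          ; comm = λ a b → ≡⇒≈ (IntP.+-comm a b) }
        ; *-cong = *-cong
        ; *-assoc = λ a b c → ≡⇒≈ (IntP.*-assoc a b c)
        ; *-identity = (λ a → ≡⇒≈ (IntP.*-identityˡ a)) , (λ a → ≡⇒≈ (IntP.*-identityʳ a))
        ; distrib = (λ a b c → ≡⇒≈ (IntP.*-distribˡ-+ a b c)) , (λ a b c → ≡⇒≈ (IntP.*-distribʳ-+ a b c)) }
      ; *-comm = λ a b → ≡⇒≈ (IntP.*-comm a b) } }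

ℤ/_ : ℕ → CommutativeRing 0ℓ 0ℓ
ℤ/ n = IntegersModulo.ring n

module _ (Δ : ℤ) where
  open Int using (_+_; _*_; _-_)

  norm : ℤ√ → ℤ
  norm (a +√ b) = a * a - b * b * Δ

  norm-mul : ∀ x y → norm (mul Δ x y) ≡ norm x * norm y
  norm-mul (a +√ b) (c +√ d) = identity a b c d Δ
    where
    identity : ∀ a b c d Δ → (a * c + b * d * Δ) * (a * c + b * d * Δ) - (a * d + b * c) * (a * d + b * c) * Δ
                             ≡ (a * a - b * b * Δ) * (c * c - d * d * Δ)
    identity = solve-∀

module QuadraticIntegersModulo (Δ : ℤ) (n : ℕ) where
  open Int using (_+_; _*_; -_)
  private module ℤ/n = CommutativeRing (ℤ/ n)

  _⊕_ : ℤ√ → ℤ√ → ℤ√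
  (a +√ b) ⊕ (c +√ d) = (a + c) +√ (b + d)

  ⊝_ : ℤ√ → ℤ√
  ⊝ (a +√ b) = (- a) +√ (- b)

  infix 4 _≈_
  record _≈_ (x y : ℤ√) : Set where
    constructor _,_
    field
      re≈ : re x ℤ/n.≈ re y
      im≈ : im x ℤ/n.≈ im y
  open _≈_ public

  private
    ≡×≡⇒≈ : ∀ {a b c d} → a ≡ c → b ≡ d → (a +√ b) ≈ (c +√ d)
    ≡×≡⇒≈ refl refl = ℤ/n.refl , ℤ/n.refl

    *-cong : ∀ {x x′ y y′} → x ≈ x′ → y ≈ y′ → mul Δ x y ≈ mul Δ x′ y′
    *-cong (a , b) (c , d) =
      ℤ/n.+-cong (ℤ/n.*-cong a c) (ℤ/n.*-cong (ℤ/n.*-cong b d) ℤ/n.refl) ,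
      ℤ/n.+-cong (ℤ/n.*-cong a d) (ℤ/n.*-cong b c)

    *-assoc : ∀ x y z → mul Δ (mul Δ x y) z ≈ mul Δ x (mul Δ y z)
    *-assoc (a +√ b) (c +√ d) (e +√ f) = ≡×≡⇒≈ (re-identity a b c d e f Δ) (im-identity a b c d e f Δ)
      where
      re-identity : ∀ a b c d e f Δ → (a * c + b * d * Δ) * e + (a * d + b * c) * f * Δ
                                       ≡ a * (c * e + d * f * Δ) + b * (c * f + d * e) * Δ
      re-identity = solve-∀
      im-identity : ∀ a b c d e f Δ → (a * c + b * d * Δ) * f + (a * d + b * c) * e
                                       ≡ a * (c * f + d * e) + b * (c * e + d * f * Δ)
      im-identity = solve-∀

    *-comm : ∀ x y → mul Δ x y ≈ mul Δ y x
    *-comm (a +√ b) (c +√ d) = ≡×≡⇒≈ (re-identity a b c d Δ) (im-identity a b c d)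
      where
      re-identity : ∀ a b c d Δ → a * c + b * d * Δ ≡ c * a + d * b * Δ
      re-identity = solve-∀
      im-identity : ∀ a b c d → a * d + b * c ≡ c * b + d * a
      im-identity = solve-∀

    *-identityˡ : ∀ x → mul Δ (one Δ) x ≈ x
    *-identityˡ (a +√ b) = ≡×≡⇒≈ (re-identity a b Δ) (im-identity a b)
      where
      re-identity : ∀ a b Δ → + 1 * a + + 0 * b * Δ ≡ a
      re-identity = solve-∀
      im-identity : ∀ a b → + 1 * b + + 0 * a ≡ b
      im-identity = solve-∀

    *-identityʳ : ∀ x → mul Δ x (one Δ) ≈ x
    *-identityʳ (a +√ b) = ≡×≡⇒≈ (re-identity a b Δ) (im-identity a b)
      where
      re-identity : ∀ a b Δ → a * + 1 + b * + 0 * Δ ≡ a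
      re-identity = solve-∀
      im-identity : ∀ a b → a * + 0 + b * + 1 ≡ b
      im-identity = solve-∀

    distribˡ : ∀ x y z → mul Δ x (y ⊕ z) ≈ mul Δ x y ⊕ mul Δ x z
    distribˡ (a +√ b) (c +√ d) (e +√ f) = ≡×≡⇒≈ (re-identity a b c d e f Δ) (im-identity a b c d e f)
      where
      re-identity : ∀ a b c d e f Δ → a * (c + e) + b * (d + f) * Δ ≡ (a * c + b * d * Δ) + (a * e + b * f * Δ)
      re-identity = solve-∀
      im-identity : ∀ a b c d e f → a * (d + f) + b * (c + e) ≡ (a * d + b * c) + (a * f + b * e)
      im-identity = solve-∀

    distribʳ : ∀ x y z → mul Δ (y ⊕ z) x ≈ mul Δ y x ⊕ mul Δ z x
    distribʳ (a +√ b) (c +√ d) (e +√ f) = ≡×≡⇒≈ (re-identity a b c d e f Δ) (im-identity a b c d e f)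
      where
      re-identity : ∀ a b c d e f Δ → (c + e) * a + (d + f) * b * Δ ≡ (c * a + d * b * Δ) + (e * a + f * b * Δ)
      re-identity = solve-∀
      im-identity : ∀ a b c d e f → (c + e) * b + (d + f) * a ≡ (c * b + d * a) + (e * b + f * a)
      im-identity = solve-∀

  ring : CommutativeRing 0ℓ 0ℓ
  ring = record
    { Carrier = ℤ√ ; _≈_ = _≈_ ; _+_ = _⊕_ ; _*_ = mul Δ ; -_ = ⊝_ ; 0# = + 0 +√ + 0 ; 1# = one Δ
    ; isCommutativeRing = record
      { isRing = record
        { +-isAbelianGroup = record
          { isGroup = record
            { isMonoid = record
              { isSemigroup = record
                { isMagma = record
                  { isEquivalence = record
                    { refl = ℤ/n.refl , ℤ/n.refl
                    ; sym = λ (a , b) → ℤ/n.sym a , ℤ/n.sym b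
                    ; trans = λ (a , b) (c , d) → ℤ/n.trans a c , ℤ/n.trans b d }
                  ; ∙-cong = λ (a , b) (c , d) → ℤ/n.+-cong a c , ℤ/n.+-cong b d }
                ; assoc = λ x y z → ≡×≡⇒≈ (IntP.+-assoc (re x) (re y) (re z)) (IntP.+-assoc (im x) (im y) (im z)) }
              ; identity = (λ x → ≡×≡⇒≈ (IntP.+-identityˡ (re x)) (IntP.+-identityˡ (im x)))
                         , (λ x → ≡×≡⇒≈ (IntP.+-identityʳ (re x)) (IntP.+-identityʳ (im x))) }
            ; inverse = (λ x → ≡×≡⇒≈ (IntP.+-inverseˡ (re x)) (IntP.+-inverseˡ (im x)))
                      , (λ x → ≡×≡⇒≈ (IntP.+-inverseʳ (re x)) (IntP.+-inverseʳ (im x)))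
            ; ⁻¹-cong = λ (a , b) → ℤ/n.-‿cong a , ℤ/n.-‿cong b }
          ; comm = λ x y → ≡×≡⇒≈ (IntP.+-comm (re x) (re y)) (IntP.+-comm (im x) (im y)) }
        ; *-cong = *-cong
        ; *-assoc = *-assoc
        ; *-identity = *-identityˡ , *-identityʳ
        ; distrib = distribˡ , distribʳ }
      ; *-comm = *-comm } }

ℤ[√_]/_ : ℤ → ℕ → CommutativeRing 0ℓ 0ℓ
ℤ[√ Δ ]/ n = QuadraticIntegersModulo.ring Δ n

module _ (n : ℕ) where
  open CommutativeRing (ℤ/ n) using (rawRing) renaming (refl to ≈-refl)
  open RingMorphisms Int.+-*-rawRing rawRing

  reduction-isRingHomomorphism : IsRingHomomorphism id
  reduction-isRingHomomorphism = record
    { isSemiringHomomorphism = record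
      { isNearSemiringHomomorphism = record
        { +-isMonoidHomomorphism = record
          { isMagmaHomomorphism = record
            { isRelHomomorphism = record { cong = IntegersModulo.≡⇒≈ n }
            ; homo = λ _ _ → ≈-refl }
          ; ε-homo = ≈-refl }
        ; *-homo = λ _ _ → ≈-refl }
      ; 1#-homo = ≈-refl }
    ; -‿homo = λ _ → ≈-refl }

module _ (Δ : ℤ) (n : ℕ) where
  private
    module ℤ/n = CommutativeRing (ℤ/ n)
  open CommutativeRing (ℤ[√ Δ ]/ n) using (rawRing) renaming (refl to ≈-refl)
  open QuadraticIntegersModulo Δ n using (_,_)
  open RingMorphisms ℤ/n.rawRing rawRing

  ι-isRingHomomorphism : IsRingHomomorphism ι
  ι-isRingHomomorphism = record
    { isSemiringHomomorphism = record
      { isNearSemiringHomomorphism = record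
        { +-isMonoidHomomorphism = record
          { isMagmaHomomorphism = record
            { isRelHomomorphism = record { cong = λ a≈b → a≈b , ℤ/n.refl }
            ; homo = λ _ _ → ≈-refl }
          ; ε-homo = ≈-refl }
        ; *-homo = λ a b → ℤ/n.reflexive (re-identity a b Δ) , ℤ/n.reflexive (im-identity a b) }
      ; 1#-homo = ≈-refl }
    ; -‿homo = λ _ → ≈-refl }
    where
    open Int using (_+_; _*_)
    re-identity : ∀ a b Δ → a * b ≡ a * b + + 0 * + 0 * Δ
    re-identity = solve-∀
    im-identity : ∀ a b → + 0 ≡ a * + 0 + + 0 * b
    im-identity = solve-∀

-- Arithmetic modulo a prime

module PrimeModulus {p} (pp : Prime p) where
  open CommutativeRing (ℤ/ p) renaming (refl to ≈-refl)
  open IntegersModulo p using (mod-divides)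
  open Frobenius (ℤ/ p) pp using (×1-^p; -‿^p)
  open IntegerHomomorphism (ℤ/ p) (reduction-isRingHomomorphism p) using (×1≈φ)
  open import Algebra.Properties.Group +-group using (inverseʳ-unique; inverseˡ-unique; x∙y⁻¹≈ε⇒x≈y)
  open import Algebra.Properties.Semiring.Exp semiring using (_^_; ^-congʳ; ^-congˡ; ^-homo-*; ^-assocʳ)
  open import Algebra.Properties.CommutativeSemiring.Exp commutativeSemiring using (^-distrib-*)
  open import Algebra.Properties.Semiring.Mult semiring using (_×_)
  open Powers (ℤ/ p) using (x^[n+n]≈[x*x]^n; [-1]^[n+n]≈1)
  open RisingFactorial (ℤ/ p) (reduction-isRingHomomorphism p) using (rising; rising≈^+⟦⟧; rising≈0; ⟦⟧-addX)
  open Polynomial (ℤ/ p) using (⟦_⟧; lagrange; xz≈yz⇒x≈y∨z≈0)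
  open import Relation.Binary.Reasoning.Setoid setoid

  ∣⇒≈0 : ∀ {a} → + p Signed.∣ a → a ≈ 0#
  ∣⇒≈0 {a} p∣a = mod-divides (subst (+ p Signed.∣_) (≡.sym (IntP.+-identityʳ a)) p∣a)

  ≈0⇒∣ : ∀ {a} → a ≈ 0# → + p Signed.∣ a
  ≈0⇒∣ {a} (mod-divides p∣a-0) = subst (+ p Signed.∣_) (IntP.+-identityʳ a) p∣a-0

  xy≈0⇒x≈0∨y≈0 : ∀ {a b} → a * b ≈ 0# → a ≈ 0# ⊎ b ≈ 0#
  xy≈0⇒x≈0∨y≈0 {a} {b} ab≈0
    with euclidsLemma Int.∣ a ∣ Int.∣ b ∣ pp (subst (p ℕ.∣_) (IntP.abs-* a b) (Signed.∣⇒∣ᵤ (≈0⇒∣ ab≈0)))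
  ... | inj₁ p∣a = inj₁ (∣⇒≈0 (Signed.∣ᵤ⇒∣ p∣a))
  ... | inj₂ p∣b = inj₂ (∣⇒≈0 (Signed.∣ᵤ⇒∣ p∣b))

  +-injective-below-p : ∀ {i j} → i < j → j < p → ¬ (+ i ≈ + j)
  +-injective-below-p {i} {j} i<j j<p (mod-divides p∣i-j) = ℕ.<⇒≱ j∸i<p (∣⇒≤ {{ℕ.>-nonZero (ℕ.m<n⇒0<n∸m i<j)}} p∣j∸i)
    where
    p∣j∸i : p ℕ.∣ j ∸ i
    p∣j∸i = subst (p ℕ.∣_) (≡.trans (cong Int.∣_∣ (IntP.m-n≡m⊖n i j)) (IntP.∣⊖∣-≤ (ℕ.<⇒≤ i<j)))
                  (Signed.∣⇒∣ᵤ p∣i-j)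
    j∸i<p : j ∸ i < p
    j∸i<p = ℕ.≤-<-trans (ℕ.m∸n≤m j i) j<p

  char : p × 1# ≈ 0#
  char = trans (×1≈φ p) (∣⇒≈0 Signed.∣-refl)

  fermat : ∀ a → a ^ p ≈ a
  fermat (+ n)    = trans (^-congˡ p (sym (×1≈φ n))) (trans (×1-^p char n) (×1≈φ n))
  fermat -[1+ n ] = trans (-‿^p char (+ suc n)) (-‿cong (fermat (+ suc n)))

  a≉0⇒a^[p-1]≈1 : ∀ {a} → ¬ a ≈ 0# → ∀ {m} → p ≡ suc m → a ^ m ≈ 1#
  a≉0⇒a^[p-1]≈1 {a} a≉0 {m} p≡1+m =
    [ id , (λ a≈0 → contradiction a≈0 a≉0) ]′ (xz≈yz⇒x≈y∨z≈0 xy≈0⇒x≈0∨y≈0 {a ^ m} {1#} {a} a^m*a≈1*a)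
    where
    a^m*a≈1*a : a ^ m * a ≈ 1# * a
    a^m*a≈1*a = trans (*-comm (a ^ m) a) (trans (^-congʳ a (≡.sym p≡1+m)) (trans (fermat a) (sym (*-identityˡ a))))

  x*x≈1⇒x≈±1 : ∀ {x} → x * x ≈ 1# → x ≈ 1# ⊎ x ≈ - 1#
  x*x≈1⇒x≈±1 {x} x*x≈1 =
    Sum.map (x∙y⁻¹≈ε⇒x≈y x 1#) (inverseˡ-unique x 1#) (xy≈0⇒x≈0∨y≈0 {x - 1#} {x + 1#} [x-1][x+1]≈0)
    where
    identity : ∀ x → (x Int.- + 1) Int.* (x Int.+ + 1) ≡ x Int.* x Int.- + 1
    identity = solve-∀
    [x-1][x+1]≈0 : (x - 1#) * (x + 1#) ≈ 0#
    [x-1][x+1]≈0 = trans (reflexive (identity x)) (trans (+-congʳ x*x≈1) (-‿inverseʳ 1#))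

  ^ℤ≡^ : ∀ a n → a ^ℤ n ≡ a ^ n
  ^ℤ≡^ a zero    = refl
  ^ℤ≡^ a (suc n) = cong (a *_) (^ℤ≡^ a n)

  rising≈0-below-p : ∀ {a} → a < p → rising (+ a) p ≈ 0#
  rising≈0-below-p {zero}  0<p = rising≈0 0<p ≈-refl
  rising≈0-below-p {suc a} a<p = rising≈0 (ℕ.∸-monoʳ-< (s≤s z≤n) (ℕ.<⇒≤ a<p))
    (∣⇒≈0 (subst (+ p Signed.∣_) (cong +_ (≡.sym (ℕ.m+[n∸m]≡n (ℕ.<⇒≤ a<p)))) Signed.∣-refl))

  -- ∏_{k<p} (x + k) − x^p + x has degree < p and vanishes at 0, …, p − 1.
  p∣risingCoefficients-addX : All (+ p Signed.∣_) (addX (risingCoefficients p))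
  p∣risingCoefficients-addX =
    All.map ≈0⇒∣ (All.map⁻ (lagrange xy≈0⇒x≈0∨y≈0 (map id Q) +_ +-injective-below-p roots))
    where
    L = risingCoefficients p
    Q = addX L
    roots : ∀ {a} → a < p → ⟦ map id Q ⟧ (+ a) ≈ 0#
    roots {a} a<p = begin
      ⟦ map id Q ⟧ (+ a)                ≈⟨ ⟦⟧-addX L (+ a) (prime>1 pp) ⟩
      ⟦ map id L ⟧ (+ a) + + a          ≈⟨ +-congʳ L≈-a^p ⟩
      - ((+ a) ^ p) + + a                 ≈⟨ +-congʳ (-‿cong (fermat (+ a))) ⟩
      - (+ a) + + a                     ≈⟨ -‿inverseˡ (+ a) ⟩
      0#                                ∎
      where
      L≈-a^p : ⟦ map id L ⟧ (+ a) ≈ - ((+ a) ^ p)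
      L≈-a^p = inverseʳ-unique ((+ a) ^ p) _ (trans (sym (rising≈^+⟦⟧ (+ a) p)) (rising≈0-below-p a<p))

  module _ {Δ} (qnr : QNR Δ p) where

    k²-Δ≉0 : ∀ k → ¬ k * k - Δ ≈ 0#
    k²-Δ≉0 k k²-Δ≈0 = qnr (k , Signed.∣⇒∣ᵤ (≈0⇒∣ k²-Δ≈0))

    Δ≉0 : ¬ Δ ≈ 0#
    Δ≉0 Δ≈0 = k²-Δ≉0 (+ 0) (trans (+-identityˡ (- Δ)) (-‿cong Δ≈0))

  module _ {h} (p≡1+2h : p ≡ suc (h ℕ.+ h)) where

    2^[h+h]≈1 : (+ 2) ^ (h ℕ.+ h) ≈ 1#
    2^[h+h]≈1 = a≉0⇒a^[p-1]≈1 2≉0 p≡1+2h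
      where
      2≉0 : ¬ (+ 2 ≈ 0#)
      2≉0 2≈0 = +-injective-below-p (s≤s z≤n) 2<p (sym 2≈0)
        where
        2<p = subst (2 <_) (≡.sym p≡1+2h) (2<1+2h {h} (subst (1 <_) p≡1+2h (prime>1 pp)))

    module _ {Δ} (Δ^h≈-1 : Δ ^ h ≈ - 1#) where

      [4Δ]^h≈-1 : (+ 4 * Δ) ^ h ≈ - 1#
      [4Δ]^h≈-1 = begin
        (+ 4 * Δ) ^ h          ≈⟨ ^-distrib-* (+ 4) Δ h ⟩
        (+ 4) ^ h * Δ ^ h      ≈⟨ *-cong (sym (x^[n+n]≈[x*x]^n (+ 2) h)) Δ^h≈-1 ⟩
        (+ 2) ^ (h ℕ.+ h) * - 1# ≈⟨ *-congʳ { - 1#} 2^[h+h]≈1 ⟩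
        1# * - 1#              ≈⟨ *-identityˡ (- 1#) ⟩
        - 1#                   ∎

      [4Δ]^[h*q]≈[-1]^q : ∀ q → (+ 4 * Δ) ^ (h ℕ.* q) ≈ (- 1#) ^ q
      [4Δ]^[h*q]≈[-1]^q q = trans (sym (^-assocʳ (+ 4 * Δ) h q)) (^-congˡ q [4Δ]^h≈-1)

      -- Multiplying by 4^q ≡ (−1)^q turns the left-hand side into (4Δ)^{hq} ≡ (−1)^q.
      [4Δ]^m*Δ^q≈1 : ∀ {q m} → h ≡ q ℕ.+ q → m ℕ.+ q ≡ h ℕ.* q → (+ 2) ^ h ≈ (- 1#) ^ q →
                     (+ 4 * Δ) ^ m * Δ ^ q ≈ 1#
      [4Δ]^m*Δ^q≈1 {q} {m} h≡q+q m+q≡h*q 2^h≈u = begin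
        X                  ≈⟨ *-identityʳ X ⟨
        X * 1#             ≈⟨ *-congˡ {X} u*u≈1 ⟨
        X * (u * u)        ≈⟨ *-assoc X u u ⟨
        (X * u) * u        ≈⟨ *-congʳ {u} X*u≈u ⟩
        u * u              ≈⟨ u*u≈1 ⟩
        1#                 ∎
        where
        u = (- 1#) ^ q
        X = (+ 4 * Δ) ^ m * Δ ^ q
        u*u≈1 : u * u ≈ 1#
        u*u≈1 = trans (sym (^-homo-* (- 1#) q q)) ([-1]^[n+n]≈1 q)
        4^q≈u : (+ 4) ^ q ≈ u
        4^q≈u = trans (sym (x^[n+n]≈[x*x]^n (+ 2) q)) (trans (reflexive (cong ((+ 2) ^_) (≡.sym h≡q+q))) 2^h≈u)
        Δ^q*4^q≈[4Δ]^q : Δ ^ q * (+ 4) ^ q ≈ (+ 4 * Δ) ^ q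
        Δ^q*4^q≈[4Δ]^q = trans (*-comm (Δ ^ q) ((+ 4) ^ q)) (sym (^-distrib-* (+ 4) Δ q))
        X*u≈u : X * u ≈ u
        X*u≈u = begin
          X * u                              ≈⟨ *-congˡ {X} 4^q≈u ⟨
          X * (+ 4) ^ q                      ≈⟨ *-assoc ((+ 4 * Δ) ^ m) (Δ ^ q) ((+ 4) ^ q) ⟩
          (+ 4 * Δ) ^ m * (Δ ^ q * (+ 4) ^ q) ≈⟨ *-congˡ {(+ 4 * Δ) ^ m} Δ^q*4^q≈[4Δ]^q ⟩
          (+ 4 * Δ) ^ m * (+ 4 * Δ) ^ q      ≈⟨ ^-homo-* (+ 4 * Δ) m q ⟨
          (+ 4 * Δ) ^ (m ℕ.+ q)              ≡⟨ cong ((+ 4 * Δ) ^_) m+q≡h*q ⟩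
          (+ 4 * Δ) ^ (h ℕ.* q)              ≈⟨ [4Δ]^[h*q]≈[-1]^q q ⟩
          u                                  ∎

module CharacteristicP {c ℓ} (R : CommutativeRing c ℓ) {φ : ℤ → CommutativeRing.Carrier R}
  (φ-hom : RingMorphisms.IsRingHomomorphism Int.+-*-rawRing (CommutativeRing.rawRing R) φ)
  {p} (pp : Prime p) (φ[p]≈0 : CommutativeRing._≈_ R (φ (+ p)) (CommutativeRing.0# R)) where
  open CommutativeRing R renaming (refl to ≈-refl)
  open RingMorphisms.IsRingHomomorphism φ-hom
  open RisingFactorial R φ-hom using (rising; rising≈^+⟦⟧; ⟦⟧-addX)
  open IntegerHomomorphism R φ-hom using (×1≈φ)
  open Polynomial R using (⟦_⟧; ⟦⟧≈0)
  open import Algebra.Properties.Semiring.Exp semiring using (_^_)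
  open import Algebra.Properties.Group +-group using (inverseˡ-unique)
  open import Relation.Binary.Reasoning.Setoid setoid

  frobenius : ∀ x y → (x + y) ^ p ≈ x ^ p + y ^ p
  frobenius = Frobenius.frobenius R pp (trans (×1≈φ p) φ[p]≈0)

  p∣c⇒φc≈0 : ∀ {c} → + p Signed.∣ c → φ c ≈ 0#
  p∣c⇒φc≈0 (Signed.divides q refl) = trans (*-homo q (+ p)) (trans (*-congˡ φ[p]≈0) (zeroʳ _))

  rising≈x^p-x : ∀ x → rising x p ≈ x ^ p - x
  rising≈x^p-x x = begin
    rising x p             ≈⟨ rising≈^+⟦⟧ x p ⟩
    x ^ p + ⟦ map φ L ⟧ x  ≈⟨ +-congˡ L≈-x ⟩
    x ^ p - x              ∎
    where
    L = risingCoefficients p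
    p∣coefficients = PrimeModulus.p∣risingCoefficients-addX pp
    L≈-x : ⟦ map φ L ⟧ x ≈ - x
    L≈-x = inverseˡ-unique _ x (begin
      ⟦ map φ L ⟧ x + x      ≈⟨ ⟦⟧-addX L x (prime>1 pp) ⟨
      ⟦ map φ (addX L) ⟧ x   ≈⟨ ⟦⟧≈0 (All.map⁺ (All.map p∣c⇒φc≈0 p∣coefficients)) x ⟩
      0#                     ∎)

-- ℤ[√Δ] modulo a prime

module QuadraticModPrime (Δ : ℤ) {p} (pp : Prime p) where
  open CommutativeRing (ℤ[√ Δ ]/ p) renaming (refl to ≈-refl)
  private
    module ℤ/p where
      open CommutativeRing (ℤ/ p) public
      open import Algebra.Properties.Semiring.Exp (CommutativeRing.semiring (ℤ/ p)) public using (_^_; ^-homo-*)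
  module ι = RingMorphisms.IsRingHomomorphism (ι-isRingHomomorphism Δ p)
  open QuadraticIntegersModulo Δ p using (_,_)
  open PrimeModulus pp using (∣⇒≈0; xy≈0⇒x≈0∨y≈0; +-injective-below-p; a≉0⇒a^[p-1]≈1; k²-Δ≉0; Δ≉0; x*x≈1⇒x≈±1)
  open import Algebra.Properties.Semiring.Exp semiring using (_^_; ^-congˡ; ^-congʳ; ^-homo-*)
  open import Algebra.Properties.CommutativeSemiring.Exp commutativeSemiring using (^-distrib-*)
  open import Relation.Binary.Reasoning.Setoid setoid

  ι∘reduction-isRingHomomorphism : RingMorphisms.IsRingHomomorphism Int.+-*-rawRing rawRing ι
  ι∘reduction-isRingHomomorphism = Composition.isRingHomomorphism trans (reduction-isRingHomomorphism p) (ι-isRingHomomorphism Δ p)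

  open RisingFactorial (ℤ[√ Δ ]/ p) ι∘reduction-isRingHomomorphism using (rising)
  open CharacteristicP (ℤ[√ Δ ]/ p) ι∘reduction-isRingHomomorphism pp (ι.⟦⟧-cong (∣⇒≈0 Signed.∣-refl))
    public using (frobenius; rising≈x^p-x)

  √Δ : ℤ√
  √Δ = + 0 +√ + 1

  pow≡^ : ∀ x n → pow Δ x n ≡ x ^ n
  pow≡^ x zero    = refl
  pow≡^ x (suc n) = cong (mul Δ x) (pow≡^ x n)

  A≡rising : ∀ n → A Δ n ≡ rising √Δ n
  A≡rising zero    = refl
  A≡rising (suc n) = cong (λ a → mul Δ a (+ n +√ + 1)) (A≡rising n)

  A≈√Δ^p-√Δ : A Δ p ≈ √Δ ^ p - √Δ
  A≈√Δ^p-√Δ = trans (reflexive (A≡rising p)) (rising≈x^p-x √Δ)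

  ι-^ : ∀ a n → ι (a ℤ/p.^ n) ≈ ι a ^ n
  ι-^ a zero    = ≈-refl
  ι-^ a (suc n) = trans (ι.*-homo a (a ℤ/p.^ n)) (*-congˡ {ι a} (ι-^ a n))

  √Δ*√Δ≈ι[Δ] : √Δ * √Δ ≈ ι Δ
  √Δ*√Δ≈ι[Δ] = ℤ/p.reflexive (identity Δ) , ℤ/p.refl
    where
    identity : ∀ Δ → + 0 Int.* + 0 Int.+ + 1 Int.* + 1 Int.* Δ ≡ Δ
    identity = solve-∀

  √Δ^[1+2h]≈√Δ*ι[Δ^h] : ∀ h → √Δ ^ suc (h ℕ.+ h) ≈ √Δ * ι (Δ ℤ/p.^ h)
  √Δ^[1+2h]≈√Δ*ι[Δ^h] h = *-congˡ {√Δ} (begin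
    √Δ ^ (h ℕ.+ h)        ≈⟨ ^-homo-* √Δ h h ⟩
    √Δ ^ h * √Δ ^ h       ≈⟨ ^-distrib-* √Δ √Δ h ⟨
    (√Δ * √Δ) ^ h         ≈⟨ ^-congˡ h √Δ*√Δ≈ι[Δ] ⟩
    ι Δ ^ h               ≈⟨ ι-^ Δ h ⟨
    ι (Δ ℤ/p.^ h)         ∎)

  norm-cong : ∀ {x y} → x ≈ y → norm Δ x ℤ/p.≈ norm Δ y
  norm-cong (a , b) = ℤ/p.+-cong (ℤ/p.*-cong a a) (ℤ/p.-‿cong (ℤ/p.*-cong (ℤ/p.*-cong b b) ℤ/p.refl))

  module _ (qnr : QNR Δ p) where

    norm[k+√Δ]≉0 : ∀ k → ¬ norm Δ (+ k +√ + 1) ℤ/p.≈ ℤ/p.0#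
    norm[k+√Δ]≉0 k N≈0 = k²-Δ≉0 qnr (+ k) (ℤ/p.trans (ℤ/p.reflexive (identity (+ k) Δ)) N≈0)
      where
      identity : ∀ k Δ → k Int.* k Int.- Δ ≡ k Int.* k Int.- + 1 Int.* + 1 Int.* Δ
      identity = solve-∀

    norm[A]≉0 : ∀ n → ¬ norm Δ (A Δ n) ℤ/p.≈ ℤ/p.0#
    norm[A]≉0 zero    1≈0 = +-injective-below-p (s≤s z≤n) (prime>1 pp) (ℤ/p.sym 1≈0)
    norm[A]≉0 (suc n) N≈0 = [ norm[A]≉0 n , norm[k+√Δ]≉0 n ]′
      (xy≈0⇒x≈0∨y≈0 {norm Δ (A Δ n)} {norm Δ (+ n +√ + 1)}
        (ℤ/p.trans (ℤ/p.reflexive (≡.sym (norm-mul Δ (A Δ n) (+ n +√ + 1)))) N≈0))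

    A≉0 : ¬ A Δ p ≈ 0#
    A≉0 A≈0 = norm[A]≉0 p (norm-cong A≈0)

    module _ {h} (p≡1+2h : p ≡ suc (h ℕ.+ h)) where

      A≈√Δ*ι[Δ^h]-√Δ : A Δ p ≈ √Δ * ι (Δ ℤ/p.^ h) - √Δ
      A≈√Δ*ι[Δ^h]-√Δ = begin
        A Δ p                      ≈⟨ A≈√Δ^p-√Δ ⟩
        √Δ ^ p - √Δ                ≈⟨ +-congʳ (^-congʳ √Δ p≡1+2h) ⟩
        √Δ ^ suc (h ℕ.+ h) - √Δ    ≈⟨ +-congʳ (√Δ^[1+2h]≈√Δ*ι[Δ^h] h) ⟩
        √Δ * ι (Δ ℤ/p.^ h) - √Δ    ∎

      euler : Δ ℤ/p.^ h ℤ/p.≈ ℤ/p.- ℤ/p.1#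
      euler = [ (λ Δ^h≈1 → contradiction (A≈0 Δ^h≈1) A≉0) , id ]′
        (x*x≈1⇒x≈±1 {Δ ℤ/p.^ h} (ℤ/p.trans (ℤ/p.sym (ℤ/p.^-homo-* Δ h h)) (a≉0⇒a^[p-1]≈1 (Δ≉0 qnr) p≡1+2h)))
        where
        A≈0 : Δ ℤ/p.^ h ℤ/p.≈ ℤ/p.1# → A Δ p ≈ 0#
        A≈0 Δ^h≈1 = begin
          A Δ p                      ≈⟨ A≈√Δ*ι[Δ^h]-√Δ ⟩
          √Δ * ι (Δ ℤ/p.^ h) - √Δ    ≈⟨ +-congʳ { - √Δ} (*-congˡ {√Δ} (ι.⟦⟧-cong Δ^h≈1)) ⟩
          √Δ * 1# - √Δ               ≈⟨ +-congʳ { - √Δ} (*-identityʳ √Δ) ⟩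
          √Δ - √Δ                    ≈⟨ -‿inverseʳ √Δ ⟩
          0#                         ∎

      A≈-2√Δ : A Δ p ≈ (+ 0 +√ -[1+ 1 ])
      A≈-2√Δ = begin
        A Δ p                      ≈⟨ A≈√Δ*ι[Δ^h]-√Δ ⟩
        √Δ * ι (Δ ℤ/p.^ h) - √Δ    ≈⟨ +-congʳ { - √Δ} (*-congˡ {√Δ} (ι.⟦⟧-cong euler)) ⟩
        √Δ * ι -[1+ 0 ] - √Δ       ≡⟨⟩
        (+ 0 +√ -[1+ 1 ])          ∎

      A*A≈ι[4Δ] : A Δ p * A Δ p ≈ ι (+ 4 Int.* Δ)
      A*A≈ι[4Δ] = trans (*-cong A≈-2√Δ A≈-2√Δ) (ℤ/p.reflexive (IntP.+-identityˡ _) , ℤ/p.refl)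

      A^[m+m]≈ι[[4Δ]^m] : ∀ m → A Δ p ^ (m ℕ.+ m) ≈ ι ((+ 4 Int.* Δ) ℤ/p.^ m)
      A^[m+m]≈ι[[4Δ]^m] m = begin
        A Δ p ^ (m ℕ.+ m)           ≈⟨ ^-homo-* (A Δ p) m m ⟩
        A Δ p ^ m * A Δ p ^ m       ≈⟨ ^-distrib-* (A Δ p) (A Δ p) m ⟨
        (A Δ p * A Δ p) ^ m         ≈⟨ ^-congˡ m A*A≈ι[4Δ] ⟩
        ι (+ 4 Int.* Δ) ^ m         ≈⟨ ι-^ (+ 4 Int.* Δ) m ⟨
        ι ((+ 4 Int.* Δ) ℤ/p.^ m)   ∎

-- (1 + i)² = 2i, so (1 + i)^p = (1 + i)(2i)^h, while Frobenius gives (1 + i)^p = 1 + i^p = 1 + i.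
module SecondSupplement {p} (pp : Prime p) {q} (p≡1+4q : p ≡ suc ((q ℕ.+ q) ℕ.+ (q ℕ.+ q))) where
  open CommutativeRing (ℤ[√ -[1+ 0 ] ]/ p) renaming (refl to ≈-refl)
  private
    module ℤ/p where
      open CommutativeRing (ℤ/ p) public
      open import Algebra.Properties.Semiring.Exp (CommutativeRing.semiring (ℤ/ p)) public using (_^_; ^-homo-*)
    module ι = RingMorphisms.IsRingHomomorphism (ι-isRingHomomorphism (-[1+ 0 ]) p)
  open QuadraticIntegersModulo (-[1+ 0 ]) p using (re≈)
  open QuadraticModPrime (-[1+ 0 ]) pp using (frobenius; ι-^) renaming (√Δ to i)
  open Powers (ℤ[√ -[1+ 0 ] ]/ p) using (1#^n≈1#; x^[n+n]≈[x*x]^n; [-1]^[n+n]≈1)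
  open Powers (ℤ/ p) using () renaming ([-1]^[n+n]≈1 to ℤ/p-[-1]^[n+n]≈1)
  open import Algebra.Properties.Semiring.Exp semiring using (_^_; ^-congʳ)
  open import Algebra.Properties.CommutativeSemiring.Exp commutativeSemiring using (^-distrib-*)
  open import Relation.Binary.Reasoning.Setoid setoid

  h : ℕ
  h = q ℕ.+ q

  i^p≈i : i ^ p ≈ i
  i^p≈i = begin
    i ^ p                  ≈⟨ ^-congʳ i p≡1+4q ⟩
    i * i ^ (h ℕ.+ h)      ≈⟨ *-congˡ {i} (x^[n+n]≈[x*x]^n i h) ⟩
    i * (i * i) ^ h        ≡⟨⟩
    i * (- 1#) ^ (q ℕ.+ q) ≈⟨ *-congˡ {i} ([-1]^[n+n]≈1 q) ⟩
    i * 1#                 ≈⟨ *-identityʳ i ⟩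
    i                      ∎

  w : ℤ√
  w = 1# + i

  u : ℤ
  u = (ℤ/p.- ℤ/p.1#) ℤ/p.^ q

  w*ι[2^h*u]≈w : w * ι ((+ 2) ℤ/p.^ h ℤ/p.* u) ≈ w
  w*ι[2^h*u]≈w = begin
    w * ι ((+ 2) ℤ/p.^ h ℤ/p.* u)     ≈⟨ *-congˡ {w} (ι.*-homo ((+ 2) ℤ/p.^ h) u) ⟩
    w * (ι ((+ 2) ℤ/p.^ h) * ι u)     ≈⟨ *-congˡ {w} (*-cong (ι-^ (+ 2) h) (ι-^ (ℤ/p.- ℤ/p.1#) q)) ⟩
    w * (ι (+ 2) ^ h * (i * i) ^ q)   ≈⟨ *-congˡ {w} (*-congˡ {ι (+ 2) ^ h} (x^[n+n]≈[x*x]^n i q)) ⟨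
    w * (ι (+ 2) ^ h * i ^ h)         ≈⟨ *-congˡ {w} (^-distrib-* (ι (+ 2)) i h) ⟨
    w * (w * w) ^ h                   ≈⟨ *-congˡ {w} (x^[n+n]≈[x*x]^n w h) ⟨
    w ^ suc (h ℕ.+ h)                 ≈⟨ ^-congʳ w p≡1+4q ⟨
    w ^ p                             ≈⟨ frobenius 1# i ⟩
    1# ^ p + i ^ p                    ≈⟨ +-cong (1#^n≈1# p) i^p≈i ⟩
    w                                 ∎

  2^h≈u : (+ 2) ℤ/p.^ h ℤ/p.≈ u
  2^h≈u = ℤ/p.trans (ℤ/p.sym (ℤ/p.*-identityʳ 2^h))
          (ℤ/p.trans (ℤ/p.*-congˡ {2^h} (ℤ/p.sym u*u≈1))
          (ℤ/p.trans (ℤ/p.sym (ℤ/p.*-assoc 2^h u u))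
          (ℤ/p.trans (ℤ/p.*-congʳ {u} 2^h*u≈1) (ℤ/p.*-identityˡ u))))
    where
    2^h = (+ 2) ℤ/p.^ h
    2^h*u≈1 : 2^h ℤ/p.* u ℤ/p.≈ ℤ/p.1#
    2^h*u≈1 = ℤ/p.trans (ℤ/p.reflexive (identity (2^h ℤ/p.* u))) (re≈ w*ι[2^h*u]≈w)
      where
      identity : ∀ c → c ≡ + 1 Int.* c Int.+ + 1 Int.* + 0 Int.* -[1+ 0 ]
      identity = solve-∀
    u*u≈1 : u ℤ/p.* u ℤ/p.≈ ℤ/p.1#
    u*u≈1 = ℤ/p.trans (ℤ/p.sym (ℤ/p.^-homo-* (ℤ/p.- ℤ/p.1#) q q)) (ℤ/p-[-1]^[n+n]≈1 q)

≈⇒≡[mod] : ∀ {Δ p x y} → CommutativeRing._≈_ (ℤ[√ Δ ]/ p) x y → x ≡ y [mod p ]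
≈⇒≡[mod] x≈y =
  Signed.∣⇒∣ᵤ (IntegersModulo.divides-diff (QuadraticIntegersModulo.re≈ x≈y)) ,
  Signed.∣⇒∣ᵤ (IntegersModulo.divides-diff (QuadraticIntegersModulo.im≈ x≈y))

p≡3[4]-case : ∀ {p} q → p ≡ 3 ℕ.+ q ℕ.* 4 → Prime p → ∀ {Δ} → QNR Δ p →
  pow Δ (A Δ p) (((p ∸ 1) ℕ.* (p ∸ 3)) ℕ./ 4) ≡ ι (-[1+ 0 ] ^ℤ ((p ∸ 3) ℕ./ 4)) [mod p ]
p≡3[4]-case {p} q refl pp {Δ} qnr = ≈⇒≡[mod] (begin
  pow Δ (A Δ p) (((p ∸ 1) ℕ.* (p ∸ 3)) ℕ./ 4)  ≡⟨ ≡.trans (pow≡^ (A Δ p) _) (cong (A Δ p ^_) E≡2hq) ⟩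
  A Δ p ^ (h ℕ.* q ℕ.+ h ℕ.* q)               ≈⟨ A^[m+m]≈ι[[4Δ]^m] qnr {h} p≡1+2h (h ℕ.* q) ⟩
  ι ((+ 4 Int.* Δ) ℤ/p.^ (h ℕ.* q))           ≈⟨ ι.⟦⟧-cong ([4Δ]^[h*q]≈[-1]^q {h} p≡1+2h (euler qnr {h} p≡1+2h) q) ⟩
  ι (-[1+ 0 ] ℤ/p.^ q)                         ≡⟨ cong ι (≡.sym (^ℤ≡^ -[1+ 0 ] q)) ⟩
  ι (-[1+ 0 ] ^ℤ q)                            ≡⟨ cong (λ n → ι (-[1+ 0 ] ^ℤ n)) (≡.sym (m*n/n≡m q 4)) ⟩
  ι (-[1+ 0 ] ^ℤ ((p ∸ 3) ℕ./ 4))              ∎)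
  where
  open CommutativeRing (ℤ[√ Δ ]/ p)
  open QuadraticModPrime Δ pp using (module ι; pow≡^; A^[m+m]≈ι[[4Δ]^m]; euler)
  open PrimeModulus pp using (^ℤ≡^; [4Δ]^[h*q]≈[-1]^q)
  open import Algebra.Properties.Semiring.Exp semiring using (_^_)
  open import Relation.Binary.Reasoning.Setoid setoid
  module ℤ/p where
    open CommutativeRing (ℤ/ p) public
    open import Algebra.Properties.Semiring.Exp (CommutativeRing.semiring (ℤ/ p)) public using (_^_)
  h = suc (q ℕ.+ q)
  p≡1+2h : 3 ℕ.+ q ℕ.* 4 ≡ suc (h ℕ.+ h)
  p≡1+2h = identity q
    where
    identity : ∀ q → 3 ℕ.+ q ℕ.* 4 ≡ suc (suc (q ℕ.+ q) ℕ.+ suc (q ℕ.+ q))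
    identity = ℕ-solve-∀
  E≡2hq : ((p ∸ 1) ℕ.* (p ∸ 3)) ℕ./ 4 ≡ h ℕ.* q ℕ.+ h ℕ.* q
  E≡2hq = ≡.trans (cong (ℕ._/ 4) (identity q)) (m*n/n≡m (h ℕ.* q ℕ.+ h ℕ.* q) 4)
    where
    identity : ∀ q → (2 ℕ.+ q ℕ.* 4) ℕ.* (q ℕ.* 4) ≡ (suc (q ℕ.+ q) ℕ.* q ℕ.+ suc (q ℕ.+ q) ℕ.* q) ℕ.* 4
    identity = ℕ-solve-∀

p≡1[4]-case : ∀ {p} q → p ≡ 1 ℕ.+ q ℕ.* 4 → Prime p → ∀ {Δ} → QNR Δ p →
  mul Δ (pow Δ (A Δ p) (((p ∸ 1) ℕ.* (p ∸ 3)) ℕ./ 4)) (ι (Δ ^ℤ ((p ∸ 1) ℕ./ 4))) ≡ one Δ [mod p ]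
p≡1[4]-case zero    refl pp = contradiction (prime>1 pp) (ℕ.<-irrefl refl)
p≡1[4]-case {p} (suc r) refl pp {Δ} qnr = ≈⇒≡[mod] (begin
  mul Δ (pow Δ (A Δ p) (((p ∸ 1) ℕ.* (p ∸ 3)) ℕ./ 4)) (ι (Δ ^ℤ ((p ∸ 1) ℕ./ 4)))
    ≡⟨ ≡.cong₂ (mul Δ) (≡.trans (pow≡^ (A Δ p) (((p ∸ 1) ℕ.* (p ∸ 3)) ℕ./ 4)) (cong (A Δ p ^_) E≡m+m))
                       (cong ι (≡.trans (cong (Δ ^ℤ_) (m*n/n≡m q 4)) (^ℤ≡^ Δ q))) ⟩
  A Δ p ^ (m ℕ.+ m) * ι (Δ ℤ/p.^ q)
    ≈⟨ *-congʳ {ι (Δ ℤ/p.^ q)} (A^[m+m]≈ι[[4Δ]^m] qnr {h} p≡1+2h m) ⟩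
  ι ((+ 4 Int.* Δ) ℤ/p.^ m) * ι (Δ ℤ/p.^ q)
    ≈⟨ ι.*-homo ((+ 4 Int.* Δ) ℤ/p.^ m) (Δ ℤ/p.^ q) ⟨
  ι ((+ 4 Int.* Δ) ℤ/p.^ m ℤ/p.* Δ ℤ/p.^ q)
    ≈⟨ ι.⟦⟧-cong ([4Δ]^m*Δ^q≈1 {h} p≡1+2h {Δ} (euler qnr {h} p≡1+2h) {q} {m} ≡.refl m+q≡h*q
                   (SecondSupplement.2^h≈u pp {q} p≡1+2h)) ⟩
  one Δ
    ∎)
  where
  open CommutativeRing (ℤ[√ Δ ]/ p)
  open QuadraticModPrime Δ pp using (module ι; pow≡^; A^[m+m]≈ι[[4Δ]^m]; euler)
  open PrimeModulus pp using (^ℤ≡^; [4Δ]^m*Δ^q≈1)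
  open import Algebra.Properties.Semiring.Exp semiring using (_^_)
  open import Relation.Binary.Reasoning.Setoid setoid
  module ℤ/p where
    open CommutativeRing (ℤ/ p) public
    open import Algebra.Properties.Semiring.Exp (CommutativeRing.semiring (ℤ/ p)) public using (_^_)
  q = suc r
  h = q ℕ.+ q
  m = q ℕ.* suc (r ℕ.+ r)
  p≡1+2h : 1 ℕ.+ suc r ℕ.* 4 ≡ suc (h ℕ.+ h)
  p≡1+2h = identity r
    where
    identity : ∀ r → 1 ℕ.+ suc r ℕ.* 4 ≡ suc ((suc r ℕ.+ suc r) ℕ.+ (suc r ℕ.+ suc r))
    identity = ℕ-solve-∀
  E≡m+m : ((p ∸ 1) ℕ.* (p ∸ 3)) ℕ./ 4 ≡ m ℕ.+ m
  E≡m+m = ≡.trans (cong (ℕ._/ 4) (identity r)) (m*n/n≡m (m ℕ.+ m) 4)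
    where
    identity : ∀ r → (suc r ℕ.* 4) ℕ.* (2 ℕ.+ r ℕ.* 4)
                     ≡ (suc r ℕ.* suc (r ℕ.+ r) ℕ.+ suc r ℕ.* suc (r ℕ.+ r)) ℕ.* 4
    identity = ℕ-solve-∀
  m+q≡h*q : m ℕ.+ q ≡ h ℕ.* q
  m+q≡h*q = identity r
    where
    identity : ∀ r → suc r ℕ.* suc (r ℕ.+ r) ℕ.+ suc r ≡ (suc r ℕ.+ suc r) ℕ.* suc r
    identity = ℕ-solve-∀

open import Data.Nat using (_/_; _%_) renaming (_*_ to _*ℕ_)
open import Data.Integer using (-_; _-_)
open import Data.Integer.Divisibility using (_∣_)
open import Data.Product using (_×_)

lemma2p1 : (p : ℕ) → Prime p → (p % 2 ≡ 1) → (Δ : ℤ) → (+ 4) ∣ (Δ - + 3) → QNR Δ p →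
    ((p % 4 ≡ 1) →
      mul Δ (pow Δ (A Δ p) (((p ∸ 1) *ℕ (p ∸ 3)) / 4)) (ι (Δ ^ℤ ((p ∸ 1) / 4))) ≡ one Δ [mod p ])
    × ((p % 4 ≡ 3) →
      pow Δ (A Δ p) (((p ∸ 1) *ℕ (p ∸ 3)) / 4) ≡ ι ((- (+ 1)) ^ℤ ((p ∸ 3) / 4)) [mod p ])
lemma2p1 p pp _ Δ _ qnr =
  (λ p%4≡1 → p≡1[4]-case (p / 4) (p≡r+[p/4]*4 p%4≡1) pp qnr) ,
  (λ p%4≡3 → p≡3[4]-case (p / 4) (p≡r+[p/4]*4 p%4≡3) pp qnr)
  where
  p≡r+[p/4]*4 : ∀ {r} → p % 4 ≡ r → p ≡ r ℕ.+ (p / 4) *ℕ 4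
  p≡r+[p/4]*4 p%4≡r = ≡.trans (m≡m%n+[m/n]*n p 4) (cong (ℕ._+ (p / 4) *ℕ 4) p%4≡r)
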